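{- Let $X\in\mathcal C$ be a closed set. Then: (1) $\bot\in X$ (as a single-leaf bunch); (2) for all bunches $\Delta,\Delta'$, if $\Delta\in X$ then $(\Delta;\Delta')\in X$; (3) if $(\Delta;\Delta)\in X$ then $\Delta\in X$; (4) $\Delta\in X$ if and only if $\lceil\Delta\rceil\in X$.
   Context: Formulas of BI: $\varphi,\psi ::= \top \mid \bot \mid \varphi\wedge\psi \mid \varphi\vee\psi \mid \varphi\to\psi \mid \mathsf{emp} \mid \varphi * \psi \mid \varphi \mathrel{ -\!\!*} \psi \mid a$ ($a\in\mathrm{Atom}$). Bunches: $\Delta ::= \varphi \mid \varnothing_m \mid \varnothing_a \mid \Delta , \Delta \mid \Delta ; \Delta$. A bunched context $\Delta(-)$ is a bunch with one hole; $\Delta(\Gamma)$ fills it. Bunch equivalence $\equiv$: least equivalence relation, closed under bunched contexts, making "$,$" commutative and associative with unit $\varnothing_m$ and "$;$" commutative and associative with unit $\varnothing_a$. The BI sequent calculus: (ax) $a\vdash a$; (equiv) from $\Delta'\vdash\varphi$, $\Delta\equiv\Delta'$ infer $\Delta\vdash\varphi$; (W;) from $\Delta(\Delta_1)\vdash\varphi$ infer $\Delta(\Delta_1;\Delta_2)\vdash\varphi$; (C;) from $\Delta(\Delta_1;\Delta_1)\vdash\varphi$ infer $\Delta(\Delta_1)\vdash\varphi$; (cut) from $\Delta'\vdash A$, $\Delta(A)\vdash B$ infer $\Delta(\Delta')\vdash B$; (empR) $\varnothing_m\vdash\mathsf{emp}$; (empL) from $\Delta(\varnothing_m)\vdash\varphi$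 infer $\Delta(\mathsf{emp})\vdash\varphi$; (*R) from $\Delta_1\vdash\varphi$, $\Delta_2\vdash\psi$ infer $\Delta_1,\Delta_2\vdash\varphi*\psi$; (*L) from $\Delta(\varphi,\psi)\vdash\chi$ infer $\Delta(\varphi*\psi)\vdash\chi$; ($-\!*$R) from $\Delta,\varphi\vdash\psi$ infer $\Delta\vdash\varphi\mathrel{ -\!\!*}\psi$; ($-\!*$L) from $\Delta_1\vdash\varphi$, $\Delta(\Delta_2,\psi)\vdash\chi$ infer $\Delta((\Delta_1,\Delta_2),\varphi\mathrel{ -\!\!*}\psi)\vdash\chi$; ($\top$R) $\varnothing_a\vdash\top$; ($\top$L) from $\Delta(\varnothing_a)\vdash\varphi$ infer $\Delta(\top)\vdash\varphi$; ($\wedge$R) from $\Delta_1\vdash\varphi$, $\Delta_2\vdash\psi$ infer $\Delta_1;\Delta_2\vdash\varphi\wedge\psi$; ($\wedge$L) from $\Delta(\varphi;\psi)\vdash\chi$ infer $\Delta(\varphi\wedge\psi)\vdash\chi$; ($\to$R) from $\Delta;\varphi\vdash\psi$ infer $\Delta\vdash\varphi\to\psi$; ($\to$L) from $\Delta_1\vdash\varphi$, $\Delta(\Delta_2;\psi)\vdash\chi$ infer $\Delta((\Delta_1;\Delta_2);\varphi\to\psi)\vdash\chi$; ($\bot$L) $\Delta(\bot)\vdash\varphi$; ($\vee$R1/2) from $\Delta\vdash\varphi$ (resp. $\Delta\vdash\psi$) infer $\Delta\vdash\varphi\vee\psi$; ($\vee$L) from $\Delta(\varphi)\vdash\chi$,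 $\Delta(\psi)\vdash\chi$ infer $\Delta(\varphi\vee\psi)\vdash\chi$. $\Delta\vdash_{\mathsf{cf}}\varphi$ means derivable without (cut). $\lceil\Delta\rceil$ is the formula obtained from $\Delta$ by replacing "$,$" by $*$, "$;$" by $\wedge$, $\varnothing_m$ by $\mathsf{emp}$, $\varnothing_a$ by $\top$. Let $\mathrm{Bunch}$ be the set of bunches modulo $\equiv$; $D(\varphi)=\{\Delta\in\mathrm{Bunch}\mid\Delta\vdash_{\mathsf{cf}}\varphi\}$; for $X\subseteq\mathrm{Bunch}$, $\mathrm{cl}(X)=\bigcap\{D(\varphi)\mid X\subseteq D(\varphi)\}$; $\mathcal C=\{X\subseteq\mathrm{Bunch}\mid X=\mathrm{cl}(X)\}$ is the set of closed sets. -}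

module Defs where

open import Data.Nat using (ℕ)
open import Data.Product using (_×_)

Atom : Set
Atom = ℕ

infixr 6 _*'_ _∧'_ _∨'_
infixr 5 _→'_ _-*_
data Formula : Set where
  ⊤' ⊥' emp : Formula
  _∧'_ _∨'_ _→'_ _*'_ _-*_ : Formula → Formula → Formula
  atom : Atom → Formula

infixl 4 _,,_ _⨾_
data Bunch : Set where
  leaf : Formula → Bunch
  ∅m ∅a : Bunch
  _,,_ : Bunch → Bunch → Bunch   -- multiplicative ","
  _⨾_  : Bunch → Bunch → Bunch   -- additive ";"

data Ctx : Set where
  hole : Ctx
  _,,ₗ_ : Ctx → Bunch → Ctx
  _,,ᵣ_ : Bunch → Ctx → Ctx
  _⨾ₗ_  : Ctx → Bunch → Ctx
  _⨾ᵣ_  : Bunch → Ctx → Ctx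

_[_] : Ctx → Bunch → Bunch
hole      [ Γ ] = Γ
(C ,,ₗ B) [ Γ ] = (C [ Γ ]) ,, B
(B ,,ᵣ C) [ Γ ] = B ,, (C [ Γ ])
(C ⨾ₗ B)  [ Γ ] = (C [ Γ ]) ⨾ B
(B ⨾ᵣ C)  [ Γ ] = B ⨾ (C [ Γ ])

infix 3 _≡B_
data _≡B_ : Bunch → Bunch → Set where
  ≡refl  : ∀ {Δ} → Δ ≡B Δ
  ≡sym   : ∀ {Δ Δ'} → Δ ≡B Δ' → Δ' ≡B Δ
  ≡trans : ∀ {Δ Δ' Δ''} → Δ ≡B Δ' → Δ' ≡B Δ'' → Δ ≡B Δ''
  ≡ctx   : ∀ (C : Ctx) {Γ Γ'} → Γ ≡B Γ' → C [ Γ ] ≡B C [ Γ' ]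
  ,-comm  : ∀ {Δ₁ Δ₂} → (Δ₁ ,, Δ₂) ≡B (Δ₂ ,, Δ₁)
  ,-assoc : ∀ {Δ₁ Δ₂ Δ₃} → ((Δ₁ ,, Δ₂) ,, Δ₃) ≡B (Δ₁ ,, (Δ₂ ,, Δ₃))
  ,-unit  : ∀ {Δ} → (Δ ,, ∅m) ≡B Δ
  ⨾-comm  : ∀ {Δ₁ Δ₂} → (Δ₁ ⨾ Δ₂) ≡B (Δ₂ ⨾ Δ₁)
  ⨾-assoc : ∀ {Δ₁ Δ₂ Δ₃} → ((Δ₁ ⨾ Δ₂) ⨾ Δ₃) ≡B (Δ₁ ⨾ (Δ₂ ⨾ Δ₃))
  ⨾-unit  : ∀ {Δ} → (Δ ⨾ ∅a) ≡B Δ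

infix 2 _⊢cf_
data _⊢cf_ : Bunch → Formula → Set where
  ax    : ∀ {a} → leaf (atom a) ⊢cf atom a
  equiv : ∀ {Δ Δ' φ} → Δ' ⊢cf φ → Δ ≡B Δ' → Δ ⊢cf φ
  W⨾    : ∀ (C : Ctx) {Δ₁ Δ₂ φ} → C [ Δ₁ ] ⊢cf φ → C [ Δ₁ ⨾ Δ₂ ] ⊢cf φ
  C⨾    : ∀ (C : Ctx) {Δ₁ φ} → C [ Δ₁ ⨾ Δ₁ ] ⊢cf φ → C [ Δ₁ ] ⊢cf φ
  empR  : ∅m ⊢cf emp
  empL  : ∀ (C : Ctx) {φ} → C [ ∅m ] ⊢cf φ → C [ leaf emp ] ⊢cf φ
  *R    : ∀ {Δ₁ Δ₂ φ ψ} → Δ₁ ⊢cf φ → Δ₂ ⊢cf ψ → (Δ₁ ,, Δ₂) ⊢cf φ *' ψ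
  *L    : ∀ (C : Ctx) {φ ψ χ} → C [ leaf φ ,, leaf ψ ] ⊢cf χ → C [ leaf (φ *' ψ) ] ⊢cf χ
  -*R   : ∀ {Δ φ ψ} → (Δ ,, leaf φ) ⊢cf ψ → Δ ⊢cf φ -* ψ
  -*L   : ∀ (C : Ctx) {Δ₁ Δ₂ φ ψ χ} → Δ₁ ⊢cf φ → C [ Δ₂ ,, leaf ψ ] ⊢cf χ
          → C [ (Δ₁ ,, Δ₂) ,, leaf (φ -* ψ) ] ⊢cf χ
  ⊤R    : ∅a ⊢cf ⊤'
  ⊤L    : ∀ (C : Ctx) {φ} → C [ ∅a ] ⊢cf φ → C [ leaf ⊤' ] ⊢cf φ
  ∧R    : ∀ {Δ₁ Δ₂ φ ψ} → Δ₁ ⊢cf φ → Δ₂ ⊢cf ψ → (Δ₁ ⨾ Δ₂) ⊢cf φ ∧' ψ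
  ∧L    : ∀ (C : Ctx) {φ ψ χ} → C [ leaf φ ⨾ leaf ψ ] ⊢cf χ → C [ leaf (φ ∧' ψ) ] ⊢cf χ
  →R    : ∀ {Δ φ ψ} → (Δ ⨾ leaf φ) ⊢cf ψ → Δ ⊢cf φ →' ψ
  →L    : ∀ (C : Ctx) {Δ₁ Δ₂ φ ψ χ} → Δ₁ ⊢cf φ → C [ Δ₂ ⨾ leaf ψ ] ⊢cf χ
          → C [ (Δ₁ ⨾ Δ₂) ⨾ leaf (φ →' ψ) ] ⊢cf χ
  ⊥L    : ∀ (C : Ctx) {φ} → C [ leaf ⊥' ] ⊢cf φ
  ∨R₁   : ∀ {Δ φ ψ} → Δ ⊢cf φ → Δ ⊢cf φ ∨' ψ
  ∨R₂   : ∀ {Δ φ ψ} → Δ ⊢cf ψ → Δ ⊢cf φ ∨' ψ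
  ∨L    : ∀ (C : Ctx) {φ ψ χ} → C [ leaf φ ] ⊢cf χ → C [ leaf ψ ] ⊢cf χ
          → C [ leaf (φ ∨' ψ) ] ⊢cf χ

⌈_⌉ : Bunch → Formula
⌈ leaf φ ⌉ = φ
⌈ ∅m ⌉ = emp
⌈ ∅a ⌉ = ⊤'
⌈ Δ₁ ,, Δ₂ ⌉ = ⌈ Δ₁ ⌉ *' ⌈ Δ₂ ⌉
⌈ Δ₁ ⨾ Δ₂ ⌉ = ⌈ Δ₁ ⌉ ∧' ⌈ Δ₂ ⌉

-- Sets of bunches are predicates on Bunch (membership of a bunch stands for
-- membership of its ≡-class).
BSet : Set₁
BSet = Bunch → Set

_⊆_ : BSet → BSet → Set
X ⊆ Y = ∀ Δ → X Δ → Y Δ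

D : Formula → BSet
D φ Δ = Δ ⊢cf φ

cl : BSet → BSet
cl X Δ = ∀ φ → X ⊆ D φ → D φ Δ

Closed : BSet → Set
Closed X = (X ⊆ cl X) × (cl X ⊆ X)

module Submission where

open import Defs
open import Data.Product using (_×_; _,_)
open import Function.Bundles using (_⇔_; mk⇔)
open import Relation.Binary.PropositionalEquality using (_≡_; refl; sym; cong; subst)

-- A closed set is an intersection of sets D(φ), so it inherits every
-- antecedent transformation that preserves cut-free derivability: ⊥L, W;, C;
-- and the left rules for emp, ⊤, *, ∧ give (1)–(3) and Δ ∈ X ⇒ ⌈Δ⌉ ∈ X.
-- The converse needs those four left rules to be invertible without cut.
-- Unfolding every leaf of the antecedent by one step (emp ↦ ∅m, ⊤ ↦ ∅a,
-- φ * ψ ↦ φ , ψ, φ ∧ ψ ↦ φ ; ψ) preserves cut-free derivability, because each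
-- rule instance survives once its freshly unfolded side formulas are folded
-- back by the left rules; refolding the surrounding context then leaves just
-- the chosen leaf unfolded.

infix 2 _⊢[_]_
_⊢[_]_ : Ctx → Bunch → Formula → Set
C ⊢[ Γ ] χ = C [ Γ ] ⊢cf χ

infix 4 _↝_
_↝_ : Bunch → Bunch → Set
Γ ↝ Γ' = ∀ C {χ} → C ⊢[ Γ ] χ → C ⊢[ Γ' ] χ

↝-refl : ∀ {Γ} → Γ ↝ Γ
↝-refl C d = d

↝-trans : ∀ {Γ Γ' Γ''} → Γ ↝ Γ' → Γ' ↝ Γ'' → Γ ↝ Γ''
↝-trans h h' C d = h' C (h C d)

infixl 5 _∘ᶜ_
_∘ᶜ_ : Ctx → Ctx → Ctx
hole      ∘ᶜ F = F
(C ,,ₗ B) ∘ᶜ F = (C ∘ᶜ F) ,,ₗ B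
(B ,,ᵣ C) ∘ᶜ F = B ,,ᵣ (C ∘ᶜ F)
(C ⨾ₗ B)  ∘ᶜ F = (C ∘ᶜ F) ⨾ₗ B
(B ⨾ᵣ C)  ∘ᶜ F = B ⨾ᵣ (C ∘ᶜ F)

∘ᶜ-[] : ∀ E F Γ → (E ∘ᶜ F) [ Γ ] ≡ E [ F [ Γ ] ]
∘ᶜ-[] hole      F Γ = refl
∘ᶜ-[] (C ,,ₗ B) F Γ = cong (_,, B) (∘ᶜ-[] C F Γ)
∘ᶜ-[] (B ,,ᵣ C) F Γ = cong (B ,,_) (∘ᶜ-[] C F Γ)
∘ᶜ-[] (C ⨾ₗ B)  F Γ = cong (_⨾ B) (∘ᶜ-[] C F Γ)
∘ᶜ-[] (B ⨾ᵣ C)  F Γ = cong (B ⨾_) (∘ᶜ-[] C F Γ)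

↝-ctx : ∀ F {Γ Γ'} → Γ ↝ Γ' → F [ Γ ] ↝ F [ Γ' ]
↝-ctx F {Γ} {Γ'} h E {χ} d =
  subst (_⊢cf χ) (∘ᶜ-[] E F Γ') (h (E ∘ᶜ F) (subst (_⊢cf χ) (sym (∘ᶜ-[] E F Γ)) d))

,,-mono-↝ : ∀ {Γ₁ Γ₁' Γ₂ Γ₂'} → Γ₁ ↝ Γ₁' → Γ₂ ↝ Γ₂' → (Γ₁ ,, Γ₂) ↝ (Γ₁' ,, Γ₂')
,,-mono-↝ {Γ₁' = Γ₁'} {Γ₂ = Γ₂} h₁ h₂ = ↝-trans (↝-ctx (hole ,,ₗ Γ₂) h₁) (↝-ctx (Γ₁' ,,ᵣ hole) h₂)

⨾-mono-↝ : ∀ {Γ₁ Γ₁' Γ₂ Γ₂'} → Γ₁ ↝ Γ₁' → Γ₂ ↝ Γ₂' → (Γ₁ ⨾ Γ₂) ↝ (Γ₁' ⨾ Γ₂')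
⨾-mono-↝ {Γ₁' = Γ₁'} {Γ₂ = Γ₂} h₁ h₂ = ↝-trans (↝-ctx (hole ⨾ₗ Γ₂) h₁) (↝-ctx (Γ₁' ⨾ᵣ hole) h₂)

unfoldLeaf : Formula → Bunch
unfoldLeaf emp      = ∅m
unfoldLeaf ⊤'       = ∅a
unfoldLeaf (φ *' ψ) = leaf φ ,, leaf ψ
unfoldLeaf (φ ∧' ψ) = leaf φ ⨾ leaf ψ
unfoldLeaf φ        = leaf φ

unfoldLeaf-↝ : ∀ φ → unfoldLeaf φ ↝ leaf φ
unfoldLeaf-↝ ⊤'       = λ C → ⊤L C
unfoldLeaf-↝ ⊥'       = ↝-refl
unfoldLeaf-↝ emp      = λ C → empL C
unfoldLeaf-↝ (φ ∧' ψ) = λ C → ∧L C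
unfoldLeaf-↝ (φ ∨' ψ) = ↝-refl
unfoldLeaf-↝ (φ →' ψ) = ↝-refl
unfoldLeaf-↝ (φ *' ψ) = λ C → *L C
unfoldLeaf-↝ (φ -* ψ) = ↝-refl
unfoldLeaf-↝ (atom a) = ↝-refl

unfold : Bunch → Bunch
unfold (leaf φ)  = unfoldLeaf φ
unfold ∅m        = ∅m
unfold ∅a        = ∅a
unfold (Γ ,, Γ') = unfold Γ ,, unfold Γ'
unfold (Γ ⨾ Γ')  = unfold Γ ⨾ unfold Γ'

unfoldᶜ : Ctx → Ctx
unfoldᶜ hole      = hole
unfoldᶜ (C ,,ₗ B) = unfoldᶜ C ,,ₗ unfold B
unfoldᶜ (B ,,ᵣ C) = unfold B ,,ᵣ unfoldᶜ C
unfoldᶜ (C ⨾ₗ B)  = unfoldᶜ C ⨾ₗ unfold B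
unfoldᶜ (B ⨾ᵣ C)  = unfold B ⨾ᵣ unfoldᶜ C

unfold-[] : ∀ C Γ → unfold (C [ Γ ]) ≡ unfoldᶜ C [ unfold Γ ]
unfold-[] hole      Γ = refl
unfold-[] (C ,,ₗ B) Γ = cong (_,, unfold B) (unfold-[] C Γ)
unfold-[] (B ,,ᵣ C) Γ = cong (unfold B ,,_) (unfold-[] C Γ)
unfold-[] (C ⨾ₗ B)  Γ = cong (_⨾ unfold B) (unfold-[] C Γ)
unfold-[] (B ⨾ᵣ C)  Γ = cong (unfold B ⨾_) (unfold-[] C Γ)

unfold-↝ : ∀ Γ → unfold Γ ↝ Γ
unfold-↝ (leaf φ)  = unfoldLeaf-↝ φ
unfold-↝ ∅m        = ↝-refl
unfold-↝ ∅a        = ↝-refl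
unfold-↝ (Γ ,, Γ') = ,,-mono-↝ (unfold-↝ Γ) (unfold-↝ Γ')
unfold-↝ (Γ ⨾ Γ')  = ⨾-mono-↝ (unfold-↝ Γ) (unfold-↝ Γ')

unfoldᶜ-↝ : ∀ C Γ → unfoldᶜ C [ Γ ] ↝ C [ Γ ]
unfoldᶜ-↝ hole      Γ = ↝-refl
unfoldᶜ-↝ (C ,,ₗ B) Γ = ,,-mono-↝ (unfoldᶜ-↝ C Γ) (unfold-↝ B)
unfoldᶜ-↝ (B ,,ᵣ C) Γ = ,,-mono-↝ (unfold-↝ B) (unfoldᶜ-↝ C Γ)
unfoldᶜ-↝ (C ⨾ₗ B)  Γ = ⨾-mono-↝ (unfoldᶜ-↝ C Γ) (unfold-↝ B)
unfoldᶜ-↝ (B ⨾ᵣ C)  Γ = ⨾-mono-↝ (unfold-↝ B) (unfoldᶜ-↝ C Γ)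

unfold-≡B : ∀ {Δ Δ'} → Δ ≡B Δ' → unfold Δ ≡B unfold Δ'
unfold-≡B ≡refl         = ≡refl
unfold-≡B (≡sym e)      = ≡sym (unfold-≡B e)
unfold-≡B (≡trans e e') = ≡trans (unfold-≡B e) (unfold-≡B e')
unfold-≡B (≡ctx C {Γ} {Γ'} e)
  rewrite unfold-[] C Γ | unfold-[] C Γ' = ≡ctx (unfoldᶜ C) (unfold-≡B e)
unfold-≡B ,-comm        = ,-comm
unfold-≡B ,-assoc       = ,-assoc
unfold-≡B ,-unit        = ,-unit
unfold-≡B ⨾-comm        = ⨾-comm
unfold-≡B ⨾-assoc       = ⨾-assoc
unfold-≡B ⨾-unit        = ⨾-unit

unfold-split : ∀ C {Γ χ} → unfold (C [ Γ ]) ⊢cf χ → unfoldᶜ C ⊢[ unfold Γ ] χ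
unfold-split C {Γ} {χ} = subst (_⊢cf χ) (unfold-[] C Γ)

unfold-merge : ∀ C {Γ χ} → unfoldᶜ C ⊢[ unfold Γ ] χ → unfold (C [ Γ ]) ⊢cf χ
unfold-merge C {Γ} {χ} = subst (_⊢cf χ) (sym (unfold-[] C Γ))

unfold-inside : ∀ C {Γ Γ' χ} → (unfoldᶜ C ⊢[ unfold Γ ] χ → unfoldᶜ C ⊢[ unfold Γ' ] χ)
              → unfold (C [ Γ ]) ⊢cf χ → unfold (C [ Γ' ]) ⊢cf χ
unfold-inside C rule d = unfold-merge C (rule (unfold-split C d))

unfold-admissible : ∀ {Γ φ} → Γ ⊢cf φ → unfold Γ ⊢cf φ
unfold-admissible ax          = ax
unfold-admissible (equiv d e) = equiv (unfold-admissible d) (unfold-≡B e)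
unfold-admissible (W⨾ C d)    = unfold-inside C (W⨾ (unfoldᶜ C)) (unfold-admissible d)
unfold-admissible (C⨾ C d)    = unfold-inside C (C⨾ (unfoldᶜ C)) (unfold-admissible d)
unfold-admissible empR        = empR
unfold-admissible (empL C d)  = unfold-inside C (λ e → e) (unfold-admissible d)
unfold-admissible (*R d d')   = *R (unfold-admissible d) (unfold-admissible d')
unfold-admissible (*L C {φ} {ψ} d) =
  unfold-inside C (,,-mono-↝ (unfoldLeaf-↝ φ) (unfoldLeaf-↝ ψ) (unfoldᶜ C)) (unfold-admissible d)
unfold-admissible (-*R {Δ} {φ} d) =
  -*R (unfoldLeaf-↝ φ (unfold Δ ,,ᵣ hole) (unfold-admissible d))
unfold-admissible (-*L C {ψ = ψ} d d') =
  unfold-inside C (λ e → -*L (unfoldᶜ C) (unfold-admissible d)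
                   (,,-mono-↝ ↝-refl (unfoldLeaf-↝ ψ) (unfoldᶜ C) e))
    (unfold-admissible d')
unfold-admissible ⊤R          = ⊤R
unfold-admissible (⊤L C d)    = unfold-inside C (λ e → e) (unfold-admissible d)
unfold-admissible (∧R d d')   = ∧R (unfold-admissible d) (unfold-admissible d')
unfold-admissible (∧L C {φ} {ψ} d) =
  unfold-inside C (⨾-mono-↝ (unfoldLeaf-↝ φ) (unfoldLeaf-↝ ψ) (unfoldᶜ C)) (unfold-admissible d)
unfold-admissible (→R {Δ} {φ} d) =
  →R (unfoldLeaf-↝ φ (unfold Δ ⨾ᵣ hole) (unfold-admissible d))
unfold-admissible (→L C {ψ = ψ} d d') =
  unfold-inside C (λ e → →L (unfoldᶜ C) (unfold-admissible d)
                   (⨾-mono-↝ ↝-refl (unfoldLeaf-↝ ψ) (unfoldᶜ C) e))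
    (unfold-admissible d')
unfold-admissible (⊥L C)      = unfold-merge C (⊥L (unfoldᶜ C))
unfold-admissible (∨R₁ d)     = ∨R₁ (unfold-admissible d)
unfold-admissible (∨R₂ d)     = ∨R₂ (unfold-admissible d)
unfold-admissible (∨L C {φ} {ψ} d d') =
  unfold-merge C (∨L (unfoldᶜ C)
    (unfoldLeaf-↝ φ (unfoldᶜ C) (unfold-split C (unfold-admissible d)))
    (unfoldLeaf-↝ ψ (unfoldᶜ C) (unfold-split C (unfold-admissible d'))))

↝-unfoldLeaf : ∀ φ → leaf φ ↝ unfoldLeaf φ
↝-unfoldLeaf φ C d = unfoldᶜ-↝ C (unfoldLeaf φ) hole (unfold-split C (unfold-admissible d))

↝-⌈⌉ : ∀ Δ → Δ ↝ leaf ⌈ Δ ⌉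
↝-⌈⌉ (leaf φ)  = ↝-refl
↝-⌈⌉ ∅m        = λ C → empL C
↝-⌈⌉ ∅a        = λ C → ⊤L C
↝-⌈⌉ (Δ ,, Δ') = ↝-trans (,,-mono-↝ (↝-⌈⌉ Δ) (↝-⌈⌉ Δ')) (λ C → *L C)
↝-⌈⌉ (Δ ⨾ Δ')  = ↝-trans (⨾-mono-↝ (↝-⌈⌉ Δ) (↝-⌈⌉ Δ')) (λ C → ∧L C)

⌈⌉-↝ : ∀ Δ → leaf ⌈ Δ ⌉ ↝ Δ
⌈⌉-↝ (leaf φ)  = ↝-refl
⌈⌉-↝ ∅m        = ↝-unfoldLeaf emp
⌈⌉-↝ ∅a        = ↝-unfoldLeaf ⊤'
⌈⌉-↝ (Δ ,, Δ') =
  ↝-trans (↝-unfoldLeaf (⌈ Δ ⌉ *' ⌈ Δ' ⌉)) (,,-mono-↝ (⌈⌉-↝ Δ) (⌈⌉-↝ Δ'))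
⌈⌉-↝ (Δ ⨾ Δ')  =
  ↝-trans (↝-unfoldLeaf (⌈ Δ ⌉ ∧' ⌈ Δ' ⌉)) (⨾-mono-↝ (⌈⌉-↝ Δ) (⌈⌉-↝ Δ'))

closed-transfer : ∀ {X Γ Γ'} → Closed X → (∀ {φ} → Γ ⊢cf φ → Γ' ⊢cf φ) → X Γ → X Γ'
closed-transfer (_ , cl⊆X) rule x = cl⊆X _ (λ φ X⊆Dφ → rule (X⊆Dφ _ x))

proposition6p2 : (X : BSet) → Closed X →
    X (leaf ⊥')
    × (∀ Δ Δ' → X Δ → X (Δ ⨾ Δ'))
    × (∀ Δ → X (Δ ⨾ Δ) → X Δ)
    × (∀ Δ → X Δ ⇔ X (leaf ⌈ Δ ⌉))
proposition6p2 X closed@(_ , cl⊆X) =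
    cl⊆X (leaf ⊥') (λ φ _ → ⊥L hole)
  , (λ Δ Δ' → closed-transfer closed (W⨾ hole))
  , (λ Δ → closed-transfer closed (C⨾ hole))
  , (λ Δ → mk⇔ (closed-transfer closed (↝-⌈⌉ Δ hole))
                (closed-transfer closed (⌈⌉-↝ Δ hole)))
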